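{- Let $\mathbf{L}=\langle L,\leq\rangle$ be a complete lattice, $S$ an $L$-parameterization, $M\subseteq L$, and $a,b\in L$. Then $M\models a\Rightarrow b$ if and only if $b\leq C_M(a)$.
   Context: An isotone Galois connection in $\mathbf{L}$ is a pair $\langle f,h\rangle$ of maps $L\to L$ with $f(a)\leq b$ iff $a\leq h(b)$; composition $\langle f_1,h_1\rangle\circ\langle f_2,h_2\rangle=\langle f_1f_2,h_2h_1\rangle$. An $L$-parameterization is a set $S$ of isotone Galois connections containing $\langle\mathrm{id},\mathrm{id}\rangle$. $M\models a\Rightarrow b$ means: for all $m\in M$ and every finite composition $\langle f,h\rangle$ of elements of $S$, $f(a)\leq m$ implies $f(b)\leq m$. $C_M(a)=\bigvee\{b\in L;\ M\models a\Rightarrow b\}$. -}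

module Defs where

open import Level using (Level; suc)
open import Data.List using (List; []; _∷_)
open import Data.List.Relation.Unary.All using (All)
open import Data.Product using (Σ; _×_; _,_)
open import Function using (_∘_; id; _⇔_; mk⇔; Equivalence)
open import Relation.Unary using (Pred; _∈_)
open import Relation.Binary.Bundles using (Poset)

record CompleteLattice (ℓ : Level) : Set (suc ℓ) where
  field
    poset : Poset ℓ ℓ ℓ
  open Poset poset public
  field
    ⋁        : Pred Carrier ℓ → Carrier
    ⋁-upper  : (X : Pred Carrier ℓ) → ∀ x → x ∈ X → x ≤ ⋁ X
    ⋁-least  : (X : Pred Carrier ℓ) → ∀ y → (∀ x → x ∈ X → x ≤ y) → ⋁ X ≤ y

module _ {ℓ : Level} (𝕃 : CompleteLattice ℓ) where
  open CompleteLattice 𝕃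

  record GaloisConnection : Set ℓ where
    field
      f      : Carrier → Carrier
      h      : Carrier → Carrier
      adjoint : ∀ a b → (f a ≤ b) ⇔ (a ≤ h b)

  open GaloisConnection

  idGC : GaloisConnection
  idGC = record { f = id ; h = id ; adjoint = λ a b → mk⇔ id id }

  _∘GC_ : GaloisConnection → GaloisConnection → GaloisConnection
  g₁ ∘GC g₂ = record
    { f = f g₁ ∘ f g₂
    ; h = h g₂ ∘ h g₁
    ; adjoint = λ a b → mk⇔
        (λ p → Equivalence.to (adjoint g₂ a (h g₁ b))
                 (Equivalence.to (adjoint g₁ (f g₂ a) b) p))
        (λ q → Equivalence.from (adjoint g₁ (f g₂ a) b)
                 (Equivalence.from (adjoint g₂ a (h g₁ b)) q))
    }

  compose : List GaloisConnection → GaloisConnection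
  compose []       = idGC
  compose (g ∷ gs) = g ∘GC compose gs

  IsParameterization : Pred GaloisConnection ℓ → Set ℓ
  IsParameterization S =
    Σ GaloisConnection λ g → g ∈ S × (∀ x → f g x ≈ x) × (∀ x → h g x ≈ x)

  _⊨_⇒_ : Pred GaloisConnection ℓ → Pred Carrier ℓ → Carrier → Carrier → Set ℓ
  _⊨_⇒_ S M a b = ∀ m → m ∈ M → (gs : List GaloisConnection) → All (_∈ S) gs →
    f (compose gs) a ≤ m → f (compose gs) b ≤ m

  C : Pred GaloisConnection ℓ → Pred Carrier ℓ → Carrier → Carrier
  C S M a = ⋁ (λ b → _⊨_⇒_ S M a b)

module Submission where

open import Defs
open import Level using (Level)
open import Function using (_⇔_; mk⇔; Equivalence)
open import Relation.Unary using (Pred)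

-- The consequences of a form a down-set closed under all joins: for each
-- instance ⟨f,h⟩ and m with f a ≤ m, every consequence lies below h m, hence
-- so does their join C_M(a), and by adjointness f (C_M(a)) ≤ m.

module Consequence {ℓ : Level} (𝕃 : CompleteLattice ℓ)
  (S : Pred (GaloisConnection 𝕃) ℓ) (M : Pred (CompleteLattice.Carrier 𝕃) ℓ)
  where

  open CompleteLattice 𝕃
  open GaloisConnection

  ⊨⇒-≤-C : ∀ {a b} → _⊨_⇒_ 𝕃 S M a b → b ≤ C 𝕃 S M a
  ⊨⇒-≤-C {a} {b} = ⋁-upper (_⊨_⇒_ 𝕃 S M a) b

  ⊨⇒-C : ∀ a → _⊨_⇒_ 𝕃 S M a (C 𝕃 S M a)
  ⊨⇒-C a m m∈M gs gs∈S fa≤m = Equivalence.from (adjoint g (C 𝕃 S M a) m) C≤hm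
    where
    g : GaloisConnection 𝕃
    g = compose 𝕃 gs

    C≤hm : C 𝕃 S M a ≤ h g m
    C≤hm = ⋁-least _ (h g m) λ x a⇒x →
      Equivalence.to (adjoint g x m) (a⇒x m m∈M gs gs∈S fa≤m)

  ⊨⇒-downward : ∀ {a b c} → b ≤ c → _⊨_⇒_ 𝕃 S M a c → _⊨_⇒_ 𝕃 S M a b
  ⊨⇒-downward {b = b} {c} b≤c a⇒c m m∈M gs gs∈S fa≤m =
    Equivalence.from (adjoint g b m)
      (trans b≤c (Equivalence.to (adjoint g c m) (a⇒c m m∈M gs gs∈S fa≤m)))
    where
    g : GaloisConnection 𝕃
    g = compose 𝕃 gs

corollary26 : {ℓ : Level} (𝕃 : CompleteLattice ℓ)
    (S : Pred (GaloisConnection 𝕃) ℓ) → IsParameterization 𝕃 S →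
    (M : Pred (CompleteLattice.Carrier 𝕃) ℓ) (a b : CompleteLattice.Carrier 𝕃) →
    (_⊨_⇒_ 𝕃 S M a b) ⇔ CompleteLattice._≤_ 𝕃 b (C 𝕃 S M a)
corollary26 𝕃 S _ M a b =
  mk⇔ ⊨⇒-≤-C (λ b≤C → ⊨⇒-downward b≤C (⊨⇒-C a))
  where open Consequence 𝕃 S M
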